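{- Let $\Lambda_h=\begin{bmatrix}1&-\frac12\\0&\frac{\sqrt3}{2}\end{bmatrix}\mathbb{Z}^2$. Let $(a,b,c)$ be a primitive Eisenstein triple, let $m,n$ be integers with $m,n>0$, $\gcd(m,n)=1$, $1\le m/n\le2$, $3\nmid(m+n)$, such that $(a,b,c)$ or $(b-a,b,c)$ equals $(m(2n-m),n(2m-n),m^2-mn+n^2)$, let $\theta\in[0,\pi/2]$ with $\cos\theta=\frac{|b-2a|}{2c}$, and let $$\Gamma_\theta=\frac12\begin{bmatrix}m+n&m-2n\\(m-n)\sqrt3&m\sqrt3\end{bmatrix}\mathbb{Z}^2.$$ If $\Omega$ is any well-rounded sublattice of $\Lambda_h$ with $\theta(\Omega)=\theta$, then $|\Gamma_\theta|\le|\Omega|$.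
   Context: An Eisenstein triple is $(a,b,c)\in\mathbb{Z}^3_{\ge0}\setminus\{(0,0,0)\}$ with $a^2-ab+b^2=c^2$; it is primitive if $a\le b$ and $\gcd(a,b,c)=1$. For a lattice $\Gamma\subset\mathbb{R}^2$, $|\Gamma|=\min\{\|y\|^2:y\in\Gamma\setminus\{0\}\}$; $\Gamma$ is well-rounded if it has a basis of two vectors attaining this minimum; such a basis can be chosen with angle in $[\pi/3,\pi/2]$ and this angle, independent of the choice, is $\theta(\Gamma)$. -}

module Defs where

open import Data.Nat as ℕ using (ℕ)
open import Data.Nat.GCD using (gcd)
open import Data.Nat.Divisibility using (_∣_)
open import Data.Integer as ℤ using (ℤ; +_; _+_; _-_; _*_; ∣_∣)
open import Data.Product using (_×_; _,_; ∃₂; ∃)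
open import Data.Sum using (_⊎_)
open import Relation.Binary.PropositionalEquality using (_≡_; _≢_)
open import Relation.Nullary using (¬_)

-- Points of the hexagonal lattice Λ_h = [[1,-1/2],[0,√3/2]] ℤ² are written
-- in coordinates (x , y) ∈ ℤ², standing for the vector (x - y/2 , y√3/2).
V : Set
V = ℤ × ℤ

zeroV : V
zeroV = (+ 0 , + 0)

_⊕_ : V → V → V
(x₁ , y₁) ⊕ (x₂ , y₂) = (x₁ + x₂ , y₁ + y₂)

_·_ : ℤ → V → V
s · (x , y) = (s * x , s * y)

-- squared Euclidean norm of the point (x - y/2 , y√3/2)
Q : V → ℤ
Q (x , y) = x * x - x * y + y * y

-- twice the Euclidean inner product (an integer)
twoB : V → V → ℤ
twoB (x₁ , y₁) (x₂ , y₂) =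
  (+ 2) * x₁ * x₂ - x₁ * y₂ - x₂ * y₁ + (+ 2) * y₁ * y₂

det : V → V → ℤ
det (x₁ , y₁) (x₂ , y₂) = x₁ * y₂ - x₂ * y₁

InL : V → V → V → Set
InL g h w = ∃₂ λ s t → w ≡ (s · g) ⊕ (t · h)

IsBasis : V → V → V → V → Set
IsBasis g h u v = InL g h u × InL g h v × InL u v g × InL u v h

-- μ = |Λ| = min { ‖w‖² : w ∈ Λ ∖ {0} } for Λ = gℤ + hℤ
IsMin : V → V → ℤ → Set
IsMin g h μ =
  (∃ λ w → InL g h w × w ≢ zeroV × Q w ≡ μ) ×
  (∀ w → InL g h w → w ≢ zeroV → μ ℤ.≤ Q w)

PrimitiveEisenstein : ℕ → ℕ → ℕ → Set
PrimitiveEisenstein a b c =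
  ¬ (a ≡ 0 × b ≡ 0 × c ≡ 0) ×
  (+ a) * (+ a) - (+ a) * (+ b) + (+ b) * (+ b) ≡ (+ c) * (+ c) ×
  a ℕ.≤ b ×
  gcd (gcd a b) c ≡ 1

ParamTriple : ℕ → ℕ → ℤ × ℤ × ℤ
ParamTriple m n =
  ( (+ m) * ((+ 2) * (+ n) - (+ m))
  , (+ n) * ((+ 2) * (+ m) - (+ n))
  , (+ m) * (+ m) - (+ m) * (+ n) + (+ n) * (+ n) )

-- Γ_θ = ½[[m+n, m-2n],[(m-n)√3, m√3]] ℤ², in Λ_h-coordinates its basis is
-- (m , m-n) and (m-n , m).
γ₁ : ℕ → ℕ → V
γ₁ m n = (+ m , + m - + n)

γ₂ : ℕ → ℕ → V
γ₂ m n = (+ m - + n , + m)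

-- Write c = Q(m, n) = m² − mn + n², which is also |γ₁|², so |Γ_θ| ≤ c.  The cosine
-- hypothesis says that c divides |b − 2a|·μ, where μ = |Ω| is the common squared length
-- of the two minimal vectors.  For both parametrisations b − 2a = ±(2c − 3n²), hence
-- c ∣ 3n²μ.  Now c is coprime to n (any common divisor divides m² = c + n(m − n)) and
-- to 3 (since (m + n)² = c + 3mn and 3 ∤ m + n), so c ∣ μ and therefore c ≤ μ.

{-# OPTIONS --safe #-}
module Submission where

open import Defs
open import Data.Nat as ℕ using (ℕ)
open import Data.Nat.GCD using (gcd)
open import Data.Nat.Divisibility using (_∣_)
open import Data.Integer as ℤ using (ℤ; +_; _+_; _-_; _*_; ∣_∣)
open import Data.Product using (_×_; _,_)
open import Data.Sum using (_⊎_)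
open import Relation.Binary.PropositionalEquality using (_≡_; _≢_)
open import Relation.Nullary using (¬_)

open import Data.Empty using (⊥-elim)
open import Data.Product using (proj₁)
open import Data.Sum using (inj₁; inj₂; [_,_]′)
open import Data.Unit using (tt)
open import Function using (id)
open import Relation.Binary.PropositionalEquality
  using (refl; sym; trans; cong; cong₂; subst; module ≡-Reasoning)
open import Relation.Nullary.Decidable using (toWitness)
import Data.Nat.Properties as ℕ
import Data.Nat.Divisibility as ℕ
open import Data.Nat.Coprimality using (Coprime; gcd≡1⇒coprime; coprime-divisor)
open import Data.Nat.Primality using (Prime; prime?; euclidsLemma; prime⇒irreducible)
import Data.Integer.Properties as ℤ
import Data.Integer.Coprimality as ℤ
import Data.Integer.Divisibility as ℤ
import Data.Integer.Divisibility.Signed as ℤˢ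
open import Data.Integer.Tactic.RingSolver using (solve-∀)

square≡∣∣² : ∀ i → i * i ≡ + (∣ i ∣ ℕ.* ∣ i ∣)
square≡∣∣² (+ k)      = sym (ℤ.pos-* k k)
square≡∣∣² ℤ.-[1+ k ] = refl

∣∣²≡0⇒≡0 : ∀ {i} → ∣ i ∣ ℕ.* ∣ i ∣ ≡ 0 → i ≡ + 0
∣∣²≡0⇒≡0 {i} e = ℤ.∣i∣≡0⇒i≡0 ([ id , id ]′ (ℕ.m*n≡0⇒m≡0∨n≡0 ∣ i ∣ e))

4Q≡sum-of-squares : ∀ x y → (+ 4) * Q (x , y) ≡ ((+ 2) * x - y) * ((+ 2) * x - y) + (+ 3) * (y * y)
4Q≡sum-of-squares x y = identity x y
  where
  identity : ∀ x y → (+ 4) * (x * x - x * y + y * y) ≡ ((+ 2) * x - y) * ((+ 2) * x - y) + (+ 3) * (y * y)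
  identity = solve-∀

Q-positive : ∀ w → w ≢ zeroV → + 0 ℤ.< Q w
Q-positive (x , y) w≢0 =
  ℤ.*-cancelˡ-<-nonNeg (+ 4) (subst (+ 0 ℤ.<_) (sym 4Q≡K) (ℤ.+<+ (ℕ.n≢0⇒n>0 K≢0)))
  where
  A : ℤ
  A = (+ 2) * x - y
  K : ℕ
  K = ∣ A ∣ ℕ.* ∣ A ∣ ℕ.+ 3 ℕ.* (∣ y ∣ ℕ.* ∣ y ∣)
  4Q≡K : (+ 4) * Q (x , y) ≡ + K
  4Q≡K = begin
    (+ 4) * Q (x , y)                                         ≡⟨ 4Q≡sum-of-squares x y ⟩
    A * A + (+ 3) * (y * y)                                   ≡⟨ cong₂ (λ p q → p + (+ 3) * q) (square≡∣∣² A) (square≡∣∣² y) ⟩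
    + (∣ A ∣ ℕ.* ∣ A ∣) + (+ 3) * + (∣ y ∣ ℕ.* ∣ y ∣)        ≡⟨ cong (λ z → + (∣ A ∣ ℕ.* ∣ A ∣) + z) (sym (ℤ.pos-* 3 (∣ y ∣ ℕ.* ∣ y ∣))) ⟩
    + (∣ A ∣ ℕ.* ∣ A ∣) + + (3 ℕ.* (∣ y ∣ ℕ.* ∣ y ∣))        ≡⟨ sym (ℤ.pos-+ (∣ A ∣ ℕ.* ∣ A ∣) (3 ℕ.* (∣ y ∣ ℕ.* ∣ y ∣))) ⟩
    + K                                                       ∎
    where open ≡-Reasoning
  K≢0 : K ≢ 0
  K≢0 K≡0 = w≢0 (cong₂ _,_ x≡0 y≡0)
    where
    A≡0 : A ≡ + 0
    A≡0 = ∣∣²≡0⇒≡0 (ℕ.m+n≡0⇒m≡0 (∣ A ∣ ℕ.* ∣ A ∣) K≡0)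
    y≡0 : y ≡ + 0
    y≡0 = ∣∣²≡0⇒≡0 ([ (λ ()) , id ]′ (ℕ.m*n≡0⇒m≡0∨n≡0 3 (ℕ.m+n≡0⇒n≡0 (∣ A ∣ ℕ.* ∣ A ∣) K≡0)))
    2x≡0 : (+ 2) * x ≡ + 0
    2x≡0 = trans (sym (ℤ.+-identityʳ ((+ 2) * x))) (subst (λ z → (+ 2) * x - z ≡ + 0) y≡0 A≡0)
    x≡0 : x ≡ + 0
    x≡0 = [ (λ ()) , id ]′ (ℤ.i*j≡0⇒i≡0∨j≡0 (+ 2) 2x≡0)

Q-shear : ∀ x y → Q (x , x - y) ≡ Q (x , y)
Q-shear x y = identity x y
  where
  identity : ∀ x y → x * x - x * (x - y) + (x - y) * (x - y) ≡ x * x - x * y + y * y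
  identity = solve-∀

InL-left : ∀ g h → InL g h g
InL-left (x₁ , y₁) (x₂ , y₂) = + 1 , + 0 , cong₂ _,_ (unit x₁ x₂) (unit y₁ y₂)
  where
  unit : ∀ p q → p ≡ (+ 1) * p + (+ 0) * q
  unit = solve-∀

IsMin⇒≤Q-left : ∀ {g h μ} → IsMin g h μ → g ≢ zeroV → μ ℤ.≤ Q g
IsMin⇒≤Q-left {g} {h} (_ , minimal) g≢0 = minimal g (InL-left g h) g≢0

IsMin⇒positive : ∀ {g h μ} → IsMin g h μ → + 0 ℤ.< μ
IsMin⇒positive ((w , _ , w≢0 , Qw≡μ) , _) = subst (+ 0 ℤ.<_) Qw≡μ (Q-positive w w≢0)

coprime-* : ∀ {c a b} → Coprime c a → Coprime c b → Coprime c (a ℕ.* b)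
coprime-* {c} {a} c⊥a c⊥b {d} (d∣c , d∣ab) = c⊥b (d∣c , coprime-divisor d⊥a d∣ab)
  where
  d⊥a : Coprime d a
  d⊥a = λ (e∣d , e∣a) → c⊥a (ℕ.∣-trans e∣d d∣c , e∣a)

∤⇒coprime : ∀ {p c} → Prime p → ¬ p ∣ c → Coprime c p
∤⇒coprime p-prime p∤c (d∣c , d∣p) with prime⇒irreducible p-prime d∣p
... | inj₁ d≡1 = d≡1
... | inj₂ refl = ⊥-elim (p∤c d∣c)

∣[k*c-e]*μ⇒∣e*μ : ∀ {c} k e μ → c ℤˢ.∣ (k * c - e) * μ → c ℤˢ.∣ e * μ
∣[k*c-e]*μ⇒∣e*μ {c} k e μ c∣ =
  subst (c ℤˢ.∣_) (identity k e μ c) (ℤˢ.∣m∣n⇒∣m-n (ℤˢ.∣m⇒∣m*n μ (ℤˢ.∣n⇒∣m*n k ℤˢ.∣-refl)) c∣)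
  where
  identity : ∀ k e μ c → (k * c) * μ - (k * c - e) * μ ≡ e * μ
  identity = solve-∀

∣∧positive⇒≤ : ∀ {c μ} → + c ℤ.∣ μ → + 0 ℤ.< μ → + c ℤ.≤ μ
∣∧positive⇒≤ {μ = ℤ.+[1+ k ]} c∣μ _             = ℤ.+≤+ (ℕ.∣⇒≤ c∣μ)
∣∧positive⇒≤ {μ = + 0}       _   (ℤ.+<+ ())

3-prime : Prime 3
3-prime = toWitness {a? = prime? 3} tt

module _ {m n c : ℕ} (c≡Q : + c ≡ Q (+ m , + n)) where

  private
    M N C : ℤ
    M = + m
    N = + n
    C = + c

  coprime-normʳ : Coprime m n → Coprime c n
  coprime-normʳ m⊥n {d} (d∣c , d∣n) = m⊥n (d∣m , d∣n)
    where
    m²≡ : C + N * (M - N) ≡ M * M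
    m²≡ = trans (cong (_+ N * (M - N)) c≡Q) (identity M N)
      where
      identity : ∀ x y → (x * x - x * y + y * y) + y * (x - y) ≡ x * x
      identity = solve-∀
    d∣m² : d ∣ m ℕ.* m
    d∣m² = subst (d ∣_) (ℤ.abs-* M M) (ℤˢ.∣⇒∣ᵤ (subst (+ d ℤˢ.∣_) m²≡
             (ℤˢ.∣m∣n⇒∣m+n (ℤˢ.∣ᵤ⇒∣ {i = C} d∣c) (ℤˢ.∣m⇒∣m*n (M - N) (ℤˢ.∣ᵤ⇒∣ {i = N} d∣n)))))
    d⊥m : Coprime d m
    d⊥m (e∣d , e∣m) = m⊥n (e∣m , ℕ.∣-trans e∣d d∣n)
    d∣m : d ∣ m
    d∣m = coprime-divisor d⊥m d∣m²

  3∤norm : ¬ 3 ∣ m ℕ.+ n → ¬ 3 ∣ c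
  3∤norm 3∤m+n 3∣c = 3∤m+n ([ id , id ]′ (euclidsLemma (m ℕ.+ n) (m ℕ.+ n) 3-prime 3∣[m+n]²))
    where
    [m+n]²≡ : C + (M * N) * (+ 3) ≡ (M + N) * (M + N)
    [m+n]²≡ = trans (cong (_+ (M * N) * (+ 3)) c≡Q) (identity M N)
      where
      identity : ∀ x y → (x * x - x * y + y * y) + (x * y) * (+ 3) ≡ (x + y) * (x + y)
      identity = solve-∀
    3∣[m+n]² : 3 ∣ (m ℕ.+ n) ℕ.* (m ℕ.+ n)
    3∣[m+n]² = subst (3 ∣_) (ℤ.abs-* (M + N) (M + N)) (ℤˢ.∣⇒∣ᵤ (subst (+ 3 ℤˢ.∣_) [m+n]²≡
                 (ℤˢ.∣m∣n⇒∣m+n (ℤˢ.∣ᵤ⇒∣ {i = C} 3∣c) (ℤˢ.∣n⇒∣m*n (M * N) ℤˢ.∣-refl))))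

  norm∣[2c-3n²]μ⇒norm∣μ : Coprime m n → ¬ 3 ∣ m ℕ.+ n →
                          ∀ μ → C ℤˢ.∣ ((+ 2) * C - (+ 3) * (N * N)) * μ → C ℤ.∣ μ
  norm∣[2c-3n²]μ⇒norm∣μ m⊥n 3∤m+n μ c∣ =
    ℤ.coprime-divisor C ((+ 3) * (N * N)) μ c⊥3n² (ℤˢ.∣⇒∣ᵤ (∣[k*c-e]*μ⇒∣e*μ (+ 2) _ μ c∣))
    where
    c⊥n : Coprime c n
    c⊥n = coprime-normʳ m⊥n
    c⊥3n² : ℤ.Coprime C ((+ 3) * (N * N))
    c⊥3n² = subst (Coprime c) (sym (trans (ℤ.abs-* (+ 3) (N * N)) (cong (3 ℕ.*_) (ℤ.abs-* N N))))
              (coprime-* (∤⇒coprime 3-prime (3∤norm 3∤m+n)) (coprime-* c⊥n c⊥n))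

param-norm : ∀ {A B C m n} → (A , B , C) ≡ ParamTriple m n → C ≡ Q (+ m , + n)
param-norm refl = refl

param-b-2a : ∀ {A B C m n} → (A , B , C) ≡ ParamTriple m n →
             B - (+ 2) * A ≡ (+ 2) * C - (+ 3) * (+ n * + n)
param-b-2a {m = m} {n} refl = identity (+ m) (+ n)
  where
  identity : ∀ x y → y * ((+ 2) * x - y) - (+ 2) * (x * ((+ 2) * y - x))
                     ≡ (+ 2) * (x * x - x * y + y * y) - (+ 3) * (y * y)
  identity = solve-∀

∣b-2a∣-param : ∀ {a b c m n} →
               (+ a , + b , + c) ≡ ParamTriple m n ⊎ (+ b - + a , + b , + c) ≡ ParamTriple m n →
               ∣ + b - (+ 2) * + a ∣ ≡ ∣ (+ 2) * + c - (+ 3) * (+ n * + n) ∣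
∣b-2a∣-param {m = m} {n} (inj₁ e) = cong ∣_∣ (param-b-2a {m = m} {n} e)
∣b-2a∣-param {a} {b} {m = m} {n} (inj₂ e) = begin
  ∣ B - (+ 2) * A ∣              ≡⟨ cong ∣_∣ (identity A B) ⟩
  ∣ ℤ.- (B - (+ 2) * (B - A)) ∣  ≡⟨ ℤ.∣-i∣≡∣i∣ (B - (+ 2) * (B - A)) ⟩
  ∣ B - (+ 2) * (B - A) ∣        ≡⟨ cong ∣_∣ (param-b-2a {m = m} {n} e) ⟩
  _                              ∎
  where
  open ≡-Reasoning
  A B : ℤ
  A = + a
  B = + b
  identity : ∀ x y → y - (+ 2) * x ≡ ℤ.- (y - (+ 2) * (y - x))
  identity = solve-∀

lemma4p8 : (a b c m n : ℕ) → PrimitiveEisenstein a b c →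
           0 ℕ.< m → 0 ℕ.< n → gcd m n ≡ 1 →
           n ℕ.≤ m → m ℕ.≤ 2 ℕ.* n → ¬ (3 ∣ (m ℕ.+ n)) →
           ((+ a , + b , + c) ≡ ParamTriple m n
             ⊎ (+ b - + a , + b , + c) ≡ ParamTriple m n) →
           (g h : V) → det g h ≢ + 0 →
           (μΩ : ℤ) → IsMin g h μΩ →
           (u v : V) → IsBasis g h u v → Q u ≡ μΩ → Q v ≡ μΩ →
           ∣ twoB u v ∣ ℕ.* c ≡ ∣ + b - (+ 2) * (+ a) ∣ ℕ.* ∣ μΩ ∣ →
           (μΓ : ℤ) → IsMin (γ₁ m n) (γ₂ m n) μΓ →
           μΓ ℤ.≤ μΩ
lemma4p8 a b c m n _ 0<m _ gcd≡1 _ _ 3∤m+n param _ _ _ μΩ minΩ u v _ _ _ cos μΓ minΓ =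
  ℤ.≤-trans μΓ≤c c≤μΩ
  where
  open ≡-Reasoning
  D : ℤ
  D = (+ 2) * + c - (+ 3) * (+ n * + n)
  c≡Q : + c ≡ Q (+ m , + n)
  c≡Q = [ param-norm {m = m} {n} , param-norm {m = m} {n} ]′ param
  γ₁≢0 : γ₁ m n ≢ zeroV
  γ₁≢0 e = ℕ.>⇒≢ 0<m (ℤ.+-injective (cong proj₁ e))
  μΓ≤c : μΓ ℤ.≤ + c
  μΓ≤c = subst (μΓ ℤ.≤_) (trans (Q-shear (+ m) (+ n)) (sym c≡Q)) (IsMin⇒≤Q-left minΓ γ₁≢0)
  c∣Dμ : + c ℤˢ.∣ D * μΩ
  c∣Dμ = ℤˢ.∣ᵤ⇒∣ (ℕ.divides ∣ twoB u v ∣ (begin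
    ∣ D * μΩ ∣                          ≡⟨ ℤ.abs-* D μΩ ⟩
    ∣ D ∣ ℕ.* ∣ μΩ ∣                     ≡⟨ cong (ℕ._* ∣ μΩ ∣) (∣b-2a∣-param {m = m} {n} param) ⟨
    ∣ + b - (+ 2) * + a ∣ ℕ.* ∣ μΩ ∣     ≡⟨ cos ⟨
    ∣ twoB u v ∣ ℕ.* c                   ∎))
  c≤μΩ : + c ℤ.≤ μΩ
  c≤μΩ = ∣∧positive⇒≤ (norm∣[2c-3n²]μ⇒norm∣μ {m} {n} c≡Q (gcd≡1⇒coprime gcd≡1) 3∤m+n μΩ c∣Dμ)
                      (IsMin⇒positive minΩ)
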